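{- Let $d\equiv 5\pmod 6$. There exists a subgroup $H$ of $\mathbb Z_2^3\times\mathbb Z_{4d}$ with $H\cong\mathbb Z_2^4$ and a $(\mathbb Z_2^{3}\times\mathbb Z_{4d},H,3,1)$-difference family.
   Context: Let $(G,+)$ be a finite abelian group and $H$ a subgroup. For a triple $T=\{a,b,c\}$ of three distinct elements of $G$, $\Delta T$ is the multiset $\{\pm(a-b),\pm(a-c),\pm(b-c)\}$, and for a set $\mathcal T$ of triples, $\Delta\mathcal T$ is the multiset union of the $\Delta T$. A $(G,H,3,1)$-difference family is a set $\mathcal T$ of triples of $G$ with $\Delta\mathcal T=G\setminus H$ as multisets (each element of $G\setminus H$ occurs exactly once, elements of $H$ do not occur). -}

module Defs where

open import Data.Nat using (ℕ; zero; suc; _+_; _∸_)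
open import Data.Nat.DivMod using (_mod_)
open import Data.Fin using (Fin; toℕ)
open import Data.Fin.Properties using () renaming (_≟_ to _≟F_)
open import Data.Product using (Σ; ∃; _×_; _,_)
open import Data.Product.Properties using (≡-dec)
open import Data.List using (List; []; _∷_; concatMap; filter; length)
open import Data.List.Relation.Unary.All using (All)
open import Relation.Binary.PropositionalEquality using (_≡_; _≢_)
open import Relation.Binary.Definitions using (DecidableEquality)
open import Relation.Nullary using (¬_)
open import Function.Definitions using (Injective)

_+ₘ_ : ∀ {m} → Fin m → Fin m → Fin m
_+ₘ_ {suc n} a b = (toℕ a + toℕ b) mod (suc n)

-ₘ_ : ∀ {m} → Fin m → Fin m
-ₘ_ {suc n} a = (suc n ∸ toℕ a) mod (suc n)

G : ℕ → Set
G m = Fin 2 × Fin 2 × Fin 2 × Fin m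

_+G_ : ∀ {m} → G m → G m → G m
(a₁ , a₂ , a₃ , a₄) +G (b₁ , b₂ , b₃ , b₄) =
  (a₁ +ₘ b₁) , (a₂ +ₘ b₂) , (a₃ +ₘ b₃) , (a₄ +ₘ b₄)

-G_ : ∀ {m} → G m → G m
-G (a₁ , a₂ , a₃ , a₄) = (-ₘ a₁) , (-ₘ a₂) , (-ₘ a₃) , (-ₘ a₄)

_-G_ : ∀ {m} → G m → G m → G m
a -G b = a +G (-G b)

_≟G_ : ∀ {m} → DecidableEquality (G m)
_≟G_ = ≡-dec _≟F_ (≡-dec _≟F_ (≡-dec _≟F_ _≟F_))

Z2⁴ : Set
Z2⁴ = G 2

IsHom : ∀ {m} → (Z2⁴ → G m) → Set
IsHom φ = ∀ x y → φ (x +G y) ≡ φ x +G φ y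

-- The image of φ (a subgroup of G m when φ is a homomorphism; isomorphic to ℤ₂⁴ when φ is injective)
Image : ∀ {m} → (Z2⁴ → G m) → G m → Set
Image φ g = ∃ λ x → φ x ≡ g

Triple : ℕ → Set
Triple m = G m × G m × G m

Distinct : ∀ {m} → Triple m → Set
Distinct (a , b , c) = (a ≢ b) × (a ≢ c) × (b ≢ c)

ΔT : ∀ {m} → Triple m → List (G m)
ΔT (a , b , c) =
  (a -G b) ∷ (b -G a) ∷ (a -G c) ∷ (c -G a) ∷ (b -G c) ∷ (c -G b) ∷ []

Δ : ∀ {m} → List (Triple m) → List (G m)
Δ 𝒯 = concatMap ΔT 𝒯

mult : ∀ {m} → G m → List (G m) → ℕ
mult g xs = length (filter (g ≟G_) xs)

IsDifferenceFamily : ∀ m → (H : G m → Set) → List (Triple m) → Set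
IsDifferenceFamily m H 𝒯 =
  All Distinct 𝒯 ×
  (∀ (g : G m) → (H g → mult g (Δ 𝒯) ≡ 0) × (¬ H g → mult g (Δ 𝒯) ≡ 1))

module Submission where

-- Write d = 5 + 3h, M = 4d = 20 + 12h and H = ℤ₂³ × {0, M/2}, the image of φ. Every triple is
-- {(0,0), (u,a), (w,a+b)} for a pair (a,b) taken from a list of blocks, each carrying a list of
-- label pairs (u,w) ∈ (ℤ₂³)²; along its three edges such a triple has the differences
-- ±(u,a), ±(w−u,b), ±(w,a+b). The blocks are chosen so that every 0 < t < M/2 occurs as a, b or
-- ±(a+b) mod M, and the label lists so that it does so with every label v ∈ ℤ₂³; hence every
-- element of G ∖ H occurs in Δ𝒯. As |Δ𝒯| + |H| = 6|𝒯| + 16 = |G|, the list Δ𝒯 followed by H is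
-- then a permutation of G by pigeonhole, so every element of G ∖ H occurs exactly once and no
-- element of H occurs. In particular no triple has a repeated point, which would put 0 ∈ H in Δ𝒯.

open import Defs
open import Algebra.Bundles using (AbelianGroup)
open import Algebra.Structures using (IsAbelianGroup)
import Algebra.Properties.AbelianGroup
open import Data.Fin using (Fin; zero; suc; toℕ)
open import Data.Fin.Properties using (toℕ-fromℕ<; toℕ-injective; toℕ<n) renaming (_≟_ to _≟F_)
open import Data.List using (List; []; _∷_; _++_; filter; length; map; concatMap; cartesianProduct; allFin)
open import Data.List.Properties
  using ( filter-++; filter-some; filter-none; filter-accept; filter-reject
        ; length-++; length-++-sucʳ; length-map; length-tabulate; concatMap-++; concatMap-map )
open import Data.List.Membership.Propositional using (_∈_; _∉_; find; lose)
open import Data.List.Membership.Propositional.Properties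
  using (∈-∃++; ∈-map⁺; ∈-map⁻; ∈-++⁺ˡ; ∈-++⁺ʳ; ∈-concatMap⁺; ∈-allFin; ∈-cartesianProduct⁺)
open import Data.List.Relation.Binary.Permutation.Propositional using (_↭_; ↭-refl; ↭-trans; prep)
open import Data.List.Relation.Binary.Permutation.Propositional.Properties using (↭-length; filter-↭; shift; ∈-resp-↭)
open import Data.List.Relation.Unary.All as All using (All; []; _∷_; all?)
open import Data.List.Relation.Unary.All.Properties using (¬Any⇒All¬)
open import Data.List.Relation.Unary.Any using (Any; here; there; any?)
open import Data.List.Relation.Unary.Unique.Propositional using (Unique; []; _∷_)
open import Data.List.Relation.Unary.Unique.Propositional.Properties using (cartesianProduct⁺; allFin⁺)
open import Data.Nat using (ℕ; zero; suc; _+_; _*_; _∸_; _≤_; _<_; s≤s⁻¹; z<s; _%_; _<?_)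
open import Data.Nat.DivMod using (_mod_; _/_; m≡m%n+[m/n]*n; _divMod_; result; %-distribˡ-+; n%n≡0; m<n⇒m%n≡m)
open import Data.Nat.Properties
  using ( module ≤-Reasoning; +-comm; +-assoc; *-assoc; +-identityʳ; suc-injective; m+n≡0⇒n≡0
        ; <⇒≤; ≤-reflexive; <-trans; n<1+n; m<m+n; 0≢1+n; <-cmp; n≢0⇒n>0; ≮⇒≥; ≤⇒≯; m≤n⇒m<n∨m≡n
        ; m+[n∸m]≡n; m≤n⇒∃[o]m+o≡n; m<n⇒0<n∸m; +-cancelˡ-<; +-monoˡ-<; *-cancelʳ-< )
open import Data.Nat.Tactic.RingSolver using (solve-∀)
open import Data.Product using (Σ; ∃; _×_; _,_; proj₁; proj₂; map₁)
open import Data.Product.Properties using (≡-dec)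
open import Data.Sum using (_⊎_; inj₁; inj₂; [_,_]′)
open import Function using (_∘_)
open import Function.Definitions using (Injective)
open import Relation.Binary.Definitions using (DecidableEquality; tri<; tri≈; tri>)
open import Relation.Binary.PropositionalEquality
open import Relation.Nullary using (¬_; Dec; yes; no; contradiction)
open import Relation.Nullary.Decidable using (True; toWitness; _⊎-dec_)
open import Relation.Unary using (Decidable)

↭-pigeonhole : ∀ {a} {A : Set a} {xs ys : List A} → Unique ys →
               (∀ {y} → y ∈ ys → y ∈ xs) → length xs ≤ length ys → xs ↭ ys
↭-pigeonhole {xs = []} [] _ _ = ↭-refl
↭-pigeonhole {ys = y ∷ ys} (y≢ys ∷ ys-unique) ys⊆xs len
  with xs₁ , xs₂ , refl ← ∈-∃++ (ys⊆xs (here refl))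
  = ↭-trans (shift y xs₁ xs₂) (prep y (↭-pigeonhole ys-unique ys⊆rest len′))
  where
  ys⊆rest : ∀ {z} → z ∈ ys → z ∈ xs₁ ++ xs₂
  ys⊆rest z∈ys with ∈-resp-↭ (shift y xs₁ xs₂) (ys⊆xs (there z∈ys))
  ... | here z≡y = contradiction (sym z≡y) (All.lookup y≢ys z∈ys)
  ... | there z∈rest = z∈rest
  len′ : length (xs₁ ++ xs₂) ≤ length ys
  len′ = s≤s⁻¹ (subst (_≤ suc (length ys)) (length-++-sucʳ xs₁ y xs₂) len)

module Multiplicity {a} {A : Set a} (_≟_ : DecidableEquality A) where

  count : A → List A → ℕ
  count x xs = length (filter (x ≟_) xs)

  count-↭ : ∀ {x xs ys} → xs ↭ ys → count x xs ≡ count x ys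
  count-↭ {x} xs↭ys = ↭-length (filter-↭ (x ≟_) xs↭ys)

  count-++ : ∀ x xs ys → count x (xs ++ ys) ≡ count x xs + count x ys
  count-++ x xs ys = trans (cong length (filter-++ (x ≟_) xs ys)) (length-++ (filter (x ≟_) xs))

  count-∈ : ∀ {x xs} → x ∈ xs → 1 ≤ count x xs
  count-∈ {x} = filter-some (x ≟_)

  count-∉ : ∀ {x xs} → x ∉ xs → count x xs ≡ 0
  count-∉ {x} x∉xs = cong length (filter-none (x ≟_) (¬Any⇒All¬ _ x∉xs))

  count-unique : ∀ {x xs} → Unique xs → x ∈ xs → count x xs ≡ 1
  count-unique {x} (x≢xs ∷ _) (here refl) =
    cong length (trans (filter-accept (x ≟_) refl) (cong (x ∷_) (filter-none (x ≟_) x≢xs)))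
  count-unique {x} (y≢xs ∷ xs-unique) (there x∈xs) =
    trans (cong length (filter-reject (x ≟_) λ x≡y → All.lookup y≢xs x∈xs (sym x≡y)))
          (count-unique xs-unique x∈xs)

module Cyclic (n : ℕ) where

  private
    M = suc n

  ⟦_⟧ : ℕ → Fin M
  ⟦ m ⟧ = m mod M

  toℕ-⟦⟧ : ∀ m → toℕ ⟦ m ⟧ ≡ m % M
  toℕ-⟦⟧ m = toℕ-fromℕ< _

  ⟦toℕ⟧ : ∀ x → ⟦ toℕ x ⟧ ≡ x
  ⟦toℕ⟧ x = toℕ-injective (trans (toℕ-⟦⟧ (toℕ x)) (m<n⇒m%n≡m (toℕ<n x)))

  ⟦⟧-homo : ∀ m k → ⟦ m ⟧ +ₘ ⟦ k ⟧ ≡ ⟦ m + k ⟧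
  ⟦⟧-homo m k = toℕ-injective (begin
    toℕ (⟦ m ⟧ +ₘ ⟦ k ⟧)    ≡⟨ toℕ-⟦⟧ (toℕ ⟦ m ⟧ + toℕ ⟦ k ⟧) ⟩
    (toℕ ⟦ m ⟧ + toℕ ⟦ k ⟧) % M ≡⟨ cong₂ (λ p q → (p + q) % M) (toℕ-⟦⟧ m) (toℕ-⟦⟧ k) ⟩
    (m % M + k % M) % M      ≡⟨ %-distribˡ-+ m k M ⟨
    (m + k) % M              ≡⟨ toℕ-⟦⟧ (m + k) ⟨
    toℕ ⟦ m + k ⟧            ∎)
    where open ≡-Reasoning

  ⟦M⟧≡0 : ⟦ M ⟧ ≡ zero
  ⟦M⟧≡0 = toℕ-injective (trans (toℕ-⟦⟧ M) (n%n≡0 M))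

  +ₘ-identityˡ : ∀ x → zero +ₘ x ≡ x
  +ₘ-identityˡ = ⟦toℕ⟧

  +ₘ-comm : ∀ x y → x +ₘ y ≡ y +ₘ x
  +ₘ-comm x y = cong ⟦_⟧ (+-comm (toℕ x) (toℕ y))

  +ₘ-identityʳ : ∀ x → x +ₘ zero ≡ x
  +ₘ-identityʳ x = trans (+ₘ-comm x zero) (+ₘ-identityˡ x)

  +ₘ-assoc : ∀ x y z → (x +ₘ y) +ₘ z ≡ x +ₘ (y +ₘ z)
  +ₘ-assoc x y z = begin
    (x +ₘ y) +ₘ z                   ≡⟨ cong ((x +ₘ y) +ₘ_) (⟦toℕ⟧ z) ⟨
    ⟦ toℕ x + toℕ y ⟧ +ₘ ⟦ toℕ z ⟧   ≡⟨ ⟦⟧-homo (toℕ x + toℕ y) (toℕ z) ⟩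
    ⟦ toℕ x + toℕ y + toℕ z ⟧       ≡⟨ cong ⟦_⟧ (+-assoc (toℕ x) _ _) ⟩
    ⟦ toℕ x + (toℕ y + toℕ z) ⟧     ≡⟨ ⟦⟧-homo (toℕ x) (toℕ y + toℕ z) ⟨
    ⟦ toℕ x ⟧ +ₘ (y +ₘ z)           ≡⟨ cong (_+ₘ (y +ₘ z)) (⟦toℕ⟧ x) ⟩
    x +ₘ (y +ₘ z)                   ∎
    where open ≡-Reasoning

  +ₘ-inverseʳ : ∀ x → x +ₘ (-ₘ x) ≡ zero
  +ₘ-inverseʳ x = begin
    x +ₘ (-ₘ x)                  ≡⟨ cong (_+ₘ (-ₘ x)) (⟦toℕ⟧ x) ⟨
    ⟦ toℕ x ⟧ +ₘ ⟦ M ∸ toℕ x ⟧    ≡⟨ ⟦⟧-homo (toℕ x) (M ∸ toℕ x) ⟩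
    ⟦ toℕ x + (M ∸ toℕ x) ⟧      ≡⟨ cong ⟦_⟧ (m+[n∸m]≡n (<⇒≤ (toℕ<n x))) ⟩
    ⟦ M ⟧                        ≡⟨ ⟦M⟧≡0 ⟩
    zero                         ∎
    where open ≡-Reasoning

  +ₘ-isAbelianGroup : IsAbelianGroup _≡_ _+ₘ_ zero -ₘ_
  +ₘ-isAbelianGroup = record
    { isGroup = record
      { isMonoid = record
        { isSemigroup = record
          { isMagma = record { isEquivalence = isEquivalence ; ∙-cong = cong₂ _+ₘ_ }
          ; assoc = +ₘ-assoc
          }
        ; identity = +ₘ-identityˡ , +ₘ-identityʳ
        }
      ; inverse = (λ x → trans (+ₘ-comm (-ₘ x) x) (+ₘ-inverseʳ x)) , +ₘ-inverseʳ
      ; ⁻¹-cong = cong -ₘ_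
      }
    ; comm = +ₘ-comm
    }

  +ₘ-abelianGroup : AbelianGroup _ _
  +ₘ-abelianGroup = record { isAbelianGroup = +ₘ-isAbelianGroup }

  open Algebra.Properties.AbelianGroup +ₘ-abelianGroup using (xyx⁻¹≈y; ⁻¹-anti-homo‿-; inverseˡ-unique)

  ⟦⟧-diff : ∀ q δ → ⟦ q + δ ⟧ +ₘ (-ₘ ⟦ q ⟧) ≡ ⟦ δ ⟧
  ⟦⟧-diff q δ = trans (cong (_+ₘ (-ₘ ⟦ q ⟧)) (sym (⟦⟧-homo q δ))) (xyx⁻¹≈y ⟦ q ⟧ ⟦ δ ⟧)

  ⟦⟧-diff⁻ : ∀ q δ → ⟦ q ⟧ +ₘ (-ₘ ⟦ q + δ ⟧) ≡ -ₘ ⟦ δ ⟧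
  ⟦⟧-diff⁻ q δ = trans (sym (⁻¹-anti-homo‿- ⟦ q + δ ⟧ ⟦ q ⟧)) (cong -ₘ_ (⟦⟧-diff q δ))

  ⟦⟧-complement : ∀ m k → m + k ≡ M → ⟦ m ⟧ ≡ -ₘ ⟦ k ⟧
  ⟦⟧-complement m k m+k≡M =
    inverseˡ-unique ⟦ m ⟧ ⟦ k ⟧ (trans (⟦⟧-homo m k) (trans (cong ⟦_⟧ m+k≡M) ⟦M⟧≡0))

length-cartesianProduct : ∀ {a b} {A : Set a} {B : Set b} (xs : List A) (ys : List B) →
                          length (cartesianProduct xs ys) ≡ length xs * length ys
length-cartesianProduct [] ys = refl
length-cartesianProduct (x ∷ xs) ys =
  trans (length-++ (map (x ,_) ys)) (cong₂ _+_ (length-map (x ,_) ys) (length-cartesianProduct xs ys))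

length-concatMap : ∀ {a b} {A : Set a} {B : Set b} {k} (f : A → List B) → (∀ x → length (f x) ≡ k) →
                   ∀ xs → length (concatMap f xs) ≡ length xs * k
length-concatMap f len-f [] = refl
length-concatMap f len-f (x ∷ xs) =
  trans (length-++ (f x)) (cong₂ _+_ (len-f x) (length-concatMap f len-f xs))

length-concatMap-++ : ∀ {a b} {A : Set a} {B : Set b} (f : A → List B) xs ys →
                      length (concatMap f (xs ++ ys)) ≡ length (concatMap f xs) + length (concatMap f ys)
length-concatMap-++ f xs ys = trans (cong length (concatMap-++ f xs ys)) (length-++ (concatMap f xs))

allG : ∀ m → List (G m)
allG m = cartesianProduct (allFin 2) (cartesianProduct (allFin 2) (cartesianProduct (allFin 2) (allFin m)))

allG-unique : ∀ m → Unique (allG m)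
allG-unique m = cartesianProduct⁺ (allFin⁺ 2) (cartesianProduct⁺ (allFin⁺ 2) (cartesianProduct⁺ (allFin⁺ 2) (allFin⁺ m)))

allG-complete : ∀ {m} (g : G m) → g ∈ allG m
allG-complete (x₁ , x₂ , x₃ , z) =
  ∈-cartesianProduct⁺ (∈-allFin x₁) (∈-cartesianProduct⁺ (∈-allFin x₂) (∈-cartesianProduct⁺ (∈-allFin x₃) (∈-allFin z)))

length-allG : ∀ m → length (allG m) ≡ 8 * m
length-allG m = begin
  length (allG m)                   ≡⟨ length-cartesianProduct (allFin 2) G₃ ⟩
  2 * length G₃                     ≡⟨ cong (2 *_) (length-cartesianProduct (allFin 2) G₂) ⟩
  2 * (2 * length G₂)               ≡⟨ cong (λ k → 2 * (2 * k)) (length-cartesianProduct (allFin 2) (allFin m)) ⟩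
  2 * (2 * (2 * length (allFin m))) ≡⟨ cong (λ k → 2 * (2 * (2 * k))) (length-tabulate {n = m} (λ i → i)) ⟩
  2 * (2 * (2 * m))                 ≡⟨ *-assoc 2 2 (2 * m) ⟨
  4 * (2 * m)                       ≡⟨ *-assoc 4 2 m ⟨
  8 * m                             ∎
  where
  open ≡-Reasoning
  G₂ = cartesianProduct (allFin 2) (allFin m)
  G₃ = cartesianProduct (allFin 2) G₂

ε : ∀ {n} → G (suc n)
ε = zero , zero , zero , zero

-G-inverseʳ : ∀ {n} (g : G (suc n)) → g -G g ≡ ε
-G-inverseʳ {n} (x₁ , x₂ , x₃ , z) =
  cong₄ (Cyclic.+ₘ-inverseʳ 1 x₁) (Cyclic.+ₘ-inverseʳ 1 x₂) (Cyclic.+ₘ-inverseʳ 1 x₃) (Cyclic.+ₘ-inverseʳ n z)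
  where
  cong₄ : ∀ {a₁ a₂ a₃ a₄ b₁ b₂ b₃ b₄} → a₁ ≡ b₁ → a₂ ≡ b₂ → a₃ ≡ b₃ → a₄ ≡ b₄ →
          (a₁ , a₂ , a₃ , a₄) ≡ (b₁ , b₂ , b₃ , b₄)
  cong₄ refl refl refl refl = refl

∈-Δ : ∀ {m} {T : Triple m} {𝒯 d} → T ∈ 𝒯 → d ∈ ΔT T → d ∈ Δ 𝒯
∈-Δ T∈𝒯 d∈ΔT = ∈-concatMap⁺ ΔT (lose T∈𝒯 d∈ΔT)

m+n≡1⇒m≡0 : ∀ {m n} → m + n ≡ 1 → 1 ≤ n → m ≡ 0
m+n≡1⇒m≡0 {zero} _ _ = refl
m+n≡1⇒m≡0 {suc m} m+n≡1 1≤n = contradiction (subst (1 ≤_) (m+n≡0⇒n≡0 m (suc-injective m+n≡1)) 1≤n) λ ()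

differenceFamily-byCounting : ∀ {n} (φ : Z2⁴ → G (suc n)) (𝒯 : List (Triple (suc n))) →
  φ ε ≡ ε → (∀ g → ¬ Image φ g → g ∈ Δ 𝒯) → length (Δ 𝒯) + 16 ≤ 8 * suc n →
  IsDifferenceFamily (suc n) (Image φ) 𝒯
differenceFamily-byCounting {n} φ 𝒯 φε≡ε covered length-bound = distinct , multiplicities
  where
  open Multiplicity (_≟G_ {suc n})
  open import Data.List.Membership.DecPropositional (_≟G_ {suc n}) using (_∈?_)

  H : List (G (suc n))
  H = map φ (allG 2)

  image⇒∈H : ∀ {g} → Image φ g → g ∈ H
  image⇒∈H (x , refl) = ∈-map⁺ φ (allG-complete x)

  ∈H⇒image : ∀ {g} → g ∈ H → Image φ g
  ∈H⇒image g∈H with x , _ , g≡φx ← ∈-map⁻ φ g∈H = x , sym g≡φx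

  Δ𝒯++H↭G : Δ 𝒯 ++ H ↭ allG (suc n)
  Δ𝒯++H↭G = ↭-pigeonhole (allG-unique (suc n)) everywhere (begin
    length (Δ 𝒯 ++ H)            ≡⟨ length-++ (Δ 𝒯) ⟩
    length (Δ 𝒯) + length H      ≡⟨ cong (length (Δ 𝒯) +_) (length-map φ (allG 2)) ⟩
    length (Δ 𝒯) + 16            ≤⟨ length-bound ⟩
    8 * suc n                    ≡⟨ length-allG (suc n) ⟨
    length (allG (suc n))        ∎)
    where
    open ≤-Reasoning
    everywhere : ∀ {g} → g ∈ allG (suc n) → g ∈ Δ 𝒯 ++ H
    everywhere {g} _ with g ∈? H
    ... | yes g∈H = ∈-++⁺ʳ (Δ 𝒯) g∈H
    ... | no  g∉H = ∈-++⁺ˡ (covered g (g∉H ∘ image⇒∈H))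

  exactly-once : ∀ g → count g (Δ 𝒯) + count g H ≡ 1
  exactly-once g = begin
    count g (Δ 𝒯) + count g H   ≡⟨ count-++ g (Δ 𝒯) H ⟨
    count g (Δ 𝒯 ++ H)          ≡⟨ count-↭ Δ𝒯++H↭G ⟩
    count g (allG (suc n))      ≡⟨ count-unique (allG-unique (suc n)) (allG-complete g) ⟩
    1                           ∎
    where open ≡-Reasoning

  multiplicities : ∀ g → (Image φ g → mult g (Δ 𝒯) ≡ 0) × (¬ Image φ g → mult g (Δ 𝒯) ≡ 1)
  multiplicities g = in-H , off-H
    where
    in-H : Image φ g → count g (Δ 𝒯) ≡ 0
    in-H img = m+n≡1⇒m≡0 (exactly-once g) (count-∈ (image⇒∈H img))
    off-H : ¬ Image φ g → count g (Δ 𝒯) ≡ 1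
    off-H ¬img = trans (sym (+-identityʳ _)) (trans (cong (count g (Δ 𝒯) +_) (sym (count-∉ (¬img ∘ ∈H⇒image)))) (exactly-once g))

  distinct : All Distinct 𝒯
  distinct = All.tabulate λ { {a , b , c} T∈𝒯 →
      repeated T∈𝒯 (here refl) , repeated T∈𝒯 (there (there (here refl))) ,
      repeated T∈𝒯 (there (there (there (there (here refl))))) }
    where
    repeated : ∀ {T x y} → T ∈ 𝒯 → x -G y ∈ ΔT T → x ≢ y
    repeated {x = x} T∈𝒯 d∈ΔT refl =
      contradiction (subst (1 ≤_) (proj₁ (multiplicities (x -G x)) zero∈H) (count-∈ (∈-Δ T∈𝒯 d∈ΔT))) λ ()
      where
      zero∈H : Image φ (x -G x)
      zero∈H = ε , trans φε≡ε (sym (-G-inverseʳ x))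

L : Set
L = Fin 2 × Fin 2 × Fin 2

O : L
O = zero , zero , zero

mkG : ∀ {m} → L → Fin m → G m
mkG (x₁ , x₂ , x₃) z = x₁ , x₂ , x₃ , z

_-L_ : L → L → L
(x₁ , x₂ , x₃) -L (y₁ , y₂ , y₃) = (x₁ +ₘ (-ₘ y₁)) , (x₂ +ₘ (-ₘ y₂)) , (x₃ +ₘ (-ₘ y₃))

-L-comm : ∀ x y → x -L y ≡ y -L x
-L-comm (x₁ , x₂ , x₃) (y₁ , y₂ , y₃) = cong₂ _,_ (ℤ₂-comm x₁ y₁) (cong₂ _,_ (ℤ₂-comm x₂ y₂) (ℤ₂-comm x₃ y₃))
  where
  ℤ₂-comm : ∀ (a b : Fin 2) → a +ₘ (-ₘ b) ≡ b +ₘ (-ₘ a)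
  ℤ₂-comm zero       zero       = refl
  ℤ₂-comm zero       (suc zero) = refl
  ℤ₂-comm (suc zero) zero       = refl
  ℤ₂-comm (suc zero) (suc zero) = refl

_≟L_ : DecidableEquality L
_≟L_ = ≡-dec _≟F_ (≡-dec _≟F_ _≟F_)

allL : List L
allL = cartesianProduct (allFin 2) (cartesianProduct (allFin 2) (allFin 2))

allL-complete : ∀ v → v ∈ allL
allL-complete (x₁ , x₂ , x₃) = ∈-cartesianProduct⁺ (∈-allFin x₁) (∈-cartesianProduct⁺ (∈-allFin x₂) (∈-allFin x₃))

decide-∀L : ∀ {p} {P : L → Set p} (P? : Decidable P) → {True (all? P? allL)} → ∀ v → P v
decide-∀L P? {checked} v = All.lookup (toWitness checked) (allL-complete v)

data Edge : Set where
  e₀₁ e₁₂ e₀₂ : Edge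

lowLabel highLabel : Edge → L × L → L
lowLabel e₀₁ _ = O
lowLabel e₁₂ (u , _) = u
lowLabel e₀₂ _ = O
highLabel e₀₁ (u , _) = u
highLabel e₁₂ (_ , w) = w
highLabel e₀₂ (_ , w) = w

Matches : Edge → L → L × L → Set
Matches e v p = highLabel e p -L lowLabel e p ≡ v

Covers : Edge → List (L × L) → L → Set
Covers e P v = Any (Matches e v) P

covers? : ∀ e P v → Dec (Covers e P v)
covers? e P v = any? (λ p → (highLabel e p -L lowLabel e p) ≟L v) P

-- σ is linear and both σ and σ − 1 are bijective, so along the edges 01, 12, 02 of the triples
-- labelled by fullLabels the label differences u, σ u − u, σ u each run over all of ℤ₂³.
-- Likewise halfLabels c c′ is built from such a map of ℤ₂², placed in the cosets with third
-- coordinate c and c′: along the three edges it covers exactly the labels with third coordinate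
-- c, c′ − c and c′, so two half blocks with complementary cosets together cover ℤ₂³.
σ : L → L
σ (x₁ , x₂ , x₃) = x₃ , x₁ +ₘ x₃ , x₂

fullLabels : List (L × L)
fullLabels = map (λ u → u , σ u) allL

halfLabels : Fin 2 → Fin 2 → List (L × L)
halfLabels c c′ = map (λ (x₁ , x₂) → (x₁ , x₂ , c) , (x₂ , x₁ +ₘ x₂ , c′)) (cartesianProduct (allFin 2) (allFin 2))

fullLabels-covers : ∀ e v → Covers e fullLabels v
fullLabels-covers e₀₁ = decide-∀L (covers? e₀₁ fullLabels)
fullLabels-covers e₁₂ = decide-∀L (covers? e₁₂ fullLabels)
fullLabels-covers e₀₂ = decide-∀L (covers? e₀₂ fullLabels)

record Block : Set where
  constructor block
  field
    a b : ℕ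
    labels : List (L × L)

low : Edge → ℕ → ℕ
low e₁₂ a = a
low _   _ = 0

δ : Edge → ℕ → ℕ → ℕ
δ e₀₁ a b = a
δ e₁₂ a b = b
δ e₀₂ a b = a + b

splits : ℕ → List (ℕ × ℕ)
splits zero    = []
splits (suc n) = (0 , n) ∷ map (map₁ suc) (splits n)

∈-splits : ∀ {i j n} → suc (i + j) ≡ n → (i , j) ∈ splits n
∈-splits {zero}  refl = here refl
∈-splits {suc i} refl = there (∈-map⁺ (map₁ suc) (∈-splits refl))

length-splits : ∀ n → length (splits n) ≡ n
length-splits zero    = refl
length-splits (suc n) = cong suc (trans (length-map (map₁ suc) (splits n)) (length-splits n))

complementʳ : ∀ {i n} → i < n → ∃ λ j → suc (i + j) ≡ n
complementʳ i<n = m≤n⇒∃[o]m+o≡n i<n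

complementˡ : ∀ {j n} → j < n → ∃ λ i → suc (i + j) ≡ n
complementˡ {j} j<n with i , j+i≡n ← m≤n⇒∃[o]m+o≡n j<n = i , trans (cong suc (+-comm i j)) j+i≡n

segment : ∀ {lo t} n {hi} → lo + n ≡ hi → lo ≤ t → (∃ λ i → i < n × t ≡ lo + i) ⊎ hi ≤ t
segment {lo} {t} n refl lo≤t with t <? lo + n
... | yes t<hi = inj₁ (t ∸ lo , +-cancelˡ-< lo (t ∸ lo) n (subst (_< lo + n) (sym t≡lo+i) t<hi) , sym t≡lo+i)
  where t≡lo+i = m+[n∸m]≡n lo≤t
... | no  t≮hi = inj₂ (≮⇒≥ t≮hi)

half+half : ∀ h → (10 + h * 6) + (10 + h * 6) ≡ 20 + h * 12
half+half = solve-∀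

segment₁-end : ∀ h → (5 + h * 2) + h ≡ 5 + h * 3
segment₁-end = solve-∀

segment₂-end : ∀ h → (6 + h * 3) + h ≡ 6 + h * 4
segment₂-end = solve-∀

segment₃-end : ∀ h → (8 + h * 4) + h ≡ 8 + h * 5
segment₃-end = solve-∀

segment₄-end : ∀ h → (10 + h * 5) + h ≡ 10 + h * 6
segment₄-end = solve-∀

F-e₀₂-sum : ∀ i j → (5 + suc (i + j) * 2 + i) + (2 + j * 2) ≡ 6 + suc (i + j) * 3 + j
F-e₀₂-sum = solve-∀

F′-e₀₂-sum : ∀ i j → (8 + suc (i + j) * 4 + i) + (3 + j * 2) ≡ 10 + suc (i + j) * 5 + j
F′-e₀₂-sum = solve-∀

H₁-e₀₂-sum : ∀ h → (4 + h * 2) + (5 + h * 3) ≡ 9 + h * 5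
H₁-e₀₂-sum = solve-∀

H₂-e₀₂-complement : ∀ h → (8 + h * 5) + (8 + h * 5) + (4 + h * 2) ≡ 20 + h * 12
H₂-e₀₂-complement = solve-∀

H₃-e₀₂-complement : ∀ h → (5 + h * 3) + (6 + h * 4) + (9 + h * 5) ≡ 20 + h * 12
H₃-e₀₂-complement = solve-∀

H₄-e₀₂-complement : ∀ h → (7 + h * 4) + (7 + h * 4) + (6 + h * 4) ≡ 20 + h * 12
H₄-e₀₂-complement = solve-∀

sizes-balance : ∀ h → (8 + (h * 8 + (h * 8 + 16))) * 6 + 16 ≡ 8 * (20 + h * 12)
sizes-balance = solve-∀

ℤ₂⁴-DifferenceFamily : ℕ → Set
ℤ₂⁴-DifferenceFamily m = Σ (Z2⁴ → G m) λ φ → IsHom φ × Injective _≡_ _≡_ φ ×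
                           Σ (List (Triple m)) λ 𝒯 → IsDifferenceFamily m (Image φ) 𝒯

1+[19+12h]≡4[5+3h] : ∀ h → suc (19 + h * 12) ≡ 4 * (5 + h * 3)
1+[19+12h]≡4[5+3h] = solve-∀

module Construction (h : ℕ) where

  N M half : ℕ
  N    = 19 + h * 12
  M    = suc N
  half = 10 + h * 6

  open Cyclic N

  triple : ℕ → ℕ → L × L → Triple M
  triple a b (u , w) = mkG O ⟦ 0 ⟧ , mkG u ⟦ a ⟧ , mkG w ⟦ a + b ⟧

  triples : Block → List (Triple M)
  triples (block a b P) = map (triple a b) P

  S H₁ H₂ H₃ H₄ : Block
  S  = block 1 (2 + h * 2) fullLabels
  H₁ = block (4 + h * 2) (5 + h * 3) (halfLabels zero zero)
  H₂ = block (8 + h * 5) (8 + h * 5) (halfLabels zero (suc zero))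
  H₃ = block (5 + h * 3) (6 + h * 4) (halfLabels (suc zero) (suc zero))
  H₄ = block (7 + h * 4) (7 + h * 4) (halfLabels zero (suc zero))

  F F′ : ℕ × ℕ → Block
  F  (i , j) = block (5 + h * 2 + i) (2 + j * 2) fullLabels
  F′ (i , j) = block (8 + h * 4 + i) (3 + j * 2) fullLabels

  Fs F′s Hs blocks : List Block
  Fs     = map F (splits h)
  F′s    = map F′ (splits h)
  Hs     = H₁ ∷ H₂ ∷ H₃ ∷ H₄ ∷ []
  blocks = S ∷ Fs ++ F′s ++ Hs

  𝒯 : List (Triple M)
  𝒯 = concatMap triples blocks

  lowEnd highEnd : Edge → ℕ → ℕ → L × L → G M
  lowEnd  e a b p = mkG (lowLabel e p) ⟦ low e a ⟧
  highEnd e a b p = mkG (highLabel e p) ⟦ low e a + δ e a b ⟧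

  ends-∈ΔT : ∀ e a b p → (highEnd e a b p -G lowEnd e a b p) ∈ ΔT (triple a b p) ×
                         (lowEnd e a b p -G highEnd e a b p) ∈ ΔT (triple a b p)
  ends-∈ΔT e₀₁ a b p = there (here refl) , here refl
  ends-∈ΔT e₁₂ a b p = there (there (there (there (there (here refl))))) , there (there (there (there (here refl))))
  ends-∈ΔT e₀₂ a b p = there (there (there (here refl))) , there (there (here refl))

  _∈±⟦_⟧ : Fin M → ℕ → Set
  x ∈±⟦ d ⟧ = x ≡ ⟦ d ⟧ ⊎ x ≡ -ₘ ⟦ d ⟧

  edge-∈ΔT : ∀ e a b p {v x} → Matches e v p → x ∈±⟦ δ e a b ⟧ → mkG v x ∈ ΔT (triple a b p)
  edge-∈ΔT e a b p matches (inj₁ refl) =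
    subst (_∈ ΔT (triple a b p)) (cong₂ mkG matches (⟦⟧-diff (low e a) (δ e a b)))
          (proj₁ (ends-∈ΔT e a b p))
  edge-∈ΔT e a b p matches (inj₂ refl) =
    subst (_∈ ΔT (triple a b p)) (cong₂ mkG (trans (-L-comm (lowLabel e p) (highLabel e p)) matches) (⟦⟧-diff⁻ (low e a) (δ e a b)))
          (proj₂ (ends-∈ΔT e a b p))

  _≡±_ : ℕ → ℕ → Set
  d ≡± t = d ≡ t ⊎ d + t ≡ M

  ±-sign : ∀ {d t} → d ≡± t → ⟦ t ⟧ ∈±⟦ d ⟧ × (-ₘ ⟦ t ⟧) ∈±⟦ d ⟧
  ±-sign (inj₁ refl) = inj₁ refl , inj₂ refl
  ±-sign {d} {t} (inj₂ d+t≡M) =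
    inj₂ (⟦⟧-complement t d (trans (+-comm t d) d+t≡M)) , inj₁ (sym (⟦⟧-complement d t d+t≡M))

  data Realised (t : ℕ) (v : L) : Set where
    realised : ∀ {a b P} → block a b P ∈ blocks → ∀ e → δ e a b ≡± t → Covers e P v → Realised t v

  realised⇒∈Δ : ∀ {t v} → Realised t v → mkG v ⟦ t ⟧ ∈ Δ 𝒯 × mkG v (-ₘ ⟦ t ⟧) ∈ Δ 𝒯
  realised⇒∈Δ (realised {a} {b} B∈ e sign covers) with p , p∈P , matches ← find covers =
    ∈-Δ T∈𝒯 (edge-∈ΔT e a b p matches (proj₁ (±-sign sign))) ,
    ∈-Δ T∈𝒯 (edge-∈ΔT e a b p matches (proj₂ (±-sign sign)))
    where T∈𝒯 = ∈-concatMap⁺ triples (lose B∈ (∈-map⁺ (triple a b) p∈P))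

  F∈ : ∀ {i j} → suc (i + j) ≡ h → F (i , j) ∈ blocks
  F∈ i+j<h = there (∈-++⁺ˡ (∈-map⁺ F (∈-splits i+j<h)))

  F′∈ : ∀ {i j} → suc (i + j) ≡ h → F′ (i , j) ∈ blocks
  F′∈ i+j<h = there (∈-++⁺ʳ Fs (∈-++⁺ˡ (∈-map⁺ F′ (∈-splits i+j<h))))

  H∈ : ∀ {B} → B ∈ Hs → B ∈ blocks
  H∈ B∈Hs = there (∈-++⁺ʳ Fs (∈-++⁺ʳ F′s B∈Hs))

  H₁∈ : H₁ ∈ blocks
  H₁∈ = H∈ (here refl)

  H₂∈ : H₂ ∈ blocks
  H₂∈ = H∈ (there (here refl))

  H₃∈ : H₃ ∈ blocks
  H₃∈ = H∈ (there (there (here refl)))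

  H₄∈ : H₄ ∈ blocks
  H₄∈ = H∈ (there (there (there (here refl))))

  -- The difference table: [1, half) splits into consecutive points and ranges of length h (2h for
  -- the first), each realised along one edge of full blocks or jointly by two half blocks.
  realise : ∀ {t} → 1 ≤ t → t < half → ∀ v → Realised t v
  realise 1≤t t<half v = table 1≤t t<half
    where
    full : ∀ {a b t} → block a b fullLabels ∈ blocks → ∀ e → δ e a b ≡± t → Realised t v
    full B∈ e sign = realised B∈ e sign (fullLabels-covers e v)

    either : ∀ {a b P a′ b′ P′ t} →
             block a b P ∈ blocks → ∀ e → δ e a b ≡± t → block a′ b′ P′ ∈ blocks → ∀ e′ → δ e′ a′ b′ ≡± t →
             {True (all? (λ u → covers? e P u ⊎-dec covers? e′ P′ u) allL)} → Realised t v
    either {P = P} {P′ = P′} B∈ e sign B′∈ e′ sign′ {checked} =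
      [ realised B∈ e sign , realised B′∈ e′ sign′ ]′
      (decide-∀L (λ u → covers? e P u ⊎-dec covers? e′ P′ u) {checked} v)

    F-e₀₂ : ∀ {i j} → suc (i + j) ≡ h → (5 + h * 2 + i) + (2 + j * 2) ≡ 6 + h * 3 + j
    F-e₀₂ {i} {j} refl = F-e₀₂-sum i j

    F′-e₀₂ : ∀ {i j} → suc (i + j) ≡ h → (8 + h * 4 + i) + (3 + j * 2) ≡ 10 + h * 5 + j
    F′-e₀₂ {i} {j} refl = F′-e₀₂-sum i j

    low-range : ∀ m → m < h * 2 → Realised (2 + m) v
    low-range m m<2h with m divMod 2
    ... | result j zero refl =
      let (i , i+j<h) = complementˡ (*-cancelʳ-< 2 j h m<2h)
      in full (F∈ {j = j} i+j<h) e₁₂ (inj₁ refl)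
    ... | result j (suc zero) refl =
      let (i , i+j<h) = complementˡ (*-cancelʳ-< 2 j h (<-trans (n<1+n (j * 2)) m<2h))
      in full (F′∈ {j = j} i+j<h) e₁₂ (inj₁ refl)

    table : ∀ {t} → 1 ≤ t → t < half → Realised t v
    table 1≤t t<half with m≤n⇒m<n∨m≡n 1≤t
    ... | inj₂ refl = full (here refl) e₀₁ (inj₁ refl)
    ... | inj₁ 2≤t with segment (h * 2) refl 2≤t
    ... | inj₁ (m , m<2h , refl) = low-range m m<2h
    ... | inj₂ 2+2h≤t with m≤n⇒m<n∨m≡n 2+2h≤t
    ... | inj₂ refl = full (here refl) e₁₂ (inj₁ refl)
    ... | inj₁ 3+2h≤t with m≤n⇒m<n∨m≡n 3+2h≤t
    ... | inj₂ refl = full (here refl) e₀₂ (inj₁ refl)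
    ... | inj₁ 4+2h≤t with m≤n⇒m<n∨m≡n 4+2h≤t
    ... | inj₂ refl = either H₁∈ e₀₁ (inj₁ refl) H₂∈ e₀₂ (inj₂ (H₂-e₀₂-complement h))
    ... | inj₁ 5+2h≤t with segment h (segment₁-end h) 5+2h≤t
    ... | inj₁ (i , i<h , refl) = let (j , i+j<h) = complementʳ i<h in full (F∈ i+j<h) e₀₁ (inj₁ refl)
    ... | inj₂ 5+3h≤t with m≤n⇒m<n∨m≡n 5+3h≤t
    ... | inj₂ refl = either H₁∈ e₁₂ (inj₁ refl) H₃∈ e₀₁ (inj₁ refl)
    ... | inj₁ 6+3h≤t with segment h (segment₂-end h) 6+3h≤t
    ... | inj₁ (j , j<h , refl) = let (i , i+j<h) = complementˡ j<h in full (F∈ i+j<h) e₀₂ (inj₁ (F-e₀₂ i+j<h))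
    ... | inj₂ 6+4h≤t with m≤n⇒m<n∨m≡n 6+4h≤t
    ... | inj₂ refl = either H₃∈ e₁₂ (inj₁ refl) H₄∈ e₀₂ (inj₂ (H₄-e₀₂-complement h))
    ... | inj₁ 7+4h≤t with m≤n⇒m<n∨m≡n 7+4h≤t
    ... | inj₂ refl = either H₄∈ e₀₁ (inj₁ refl) H₄∈ e₁₂ (inj₁ refl)
    ... | inj₁ 8+4h≤t with segment h (segment₃-end h) 8+4h≤t
    ... | inj₁ (i , i<h , refl) = let (j , i+j<h) = complementʳ i<h in full (F′∈ i+j<h) e₀₁ (inj₁ refl)
    ... | inj₂ 8+5h≤t with m≤n⇒m<n∨m≡n 8+5h≤t
    ... | inj₂ refl = either H₂∈ e₀₁ (inj₁ refl) H₂∈ e₁₂ (inj₁ refl)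
    ... | inj₁ 9+5h≤t with m≤n⇒m<n∨m≡n 9+5h≤t
    ... | inj₂ refl = either H₁∈ e₀₂ (inj₁ (H₁-e₀₂-sum h)) H₃∈ e₀₂ (inj₂ (H₃-e₀₂-complement h))
    ... | inj₁ 10+5h≤t with segment h (segment₄-end h) 10+5h≤t
    ... | inj₁ (j , j<h , refl) = let (i , i+j<h) = complementˡ j<h in full (F′∈ i+j<h) e₀₂ (inj₁ (F′-e₀₂ i+j<h))
    ... | inj₂ half≤t = contradiction t<half (≤⇒≯ half≤t)

  half<M : half < M
  half<M = subst (half <_) (half+half h) (m<m+n half z<s)

  toℕ-⟦half⟧ : toℕ ⟦ half ⟧ ≡ half
  toℕ-⟦half⟧ = trans (toℕ-⟦⟧ half) (m<n⇒m%n≡m half<M)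

  embed : Fin 2 → Fin M
  embed zero       = zero
  embed (suc zero) = ⟦ half ⟧

  embed-homo : ∀ e e′ → embed (e +ₘ e′) ≡ embed e +ₘ embed e′
  embed-homo zero       zero       = sym (+ₘ-identityˡ zero)
  embed-homo zero       (suc zero) = sym (+ₘ-identityˡ ⟦ half ⟧)
  embed-homo (suc zero) zero       = sym (+ₘ-identityʳ ⟦ half ⟧)
  embed-homo (suc zero) (suc zero) = sym (trans (⟦⟧-homo half half) (trans (cong ⟦_⟧ (half+half h)) ⟦M⟧≡0))

  φ : Z2⁴ → G M
  φ (x₁ , x₂ , x₃ , e) = x₁ , x₂ , x₃ , embed e

  φ-homo : IsHom φ
  φ-homo (x₁ , x₂ , x₃ , e) (y₁ , y₂ , y₃ , e′) =
    cong (λ z → (x₁ +ₘ y₁) , (x₂ +ₘ y₂) , (x₃ +ₘ y₃) , z) (embed-homo e e′)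

  φ-injective : Injective _≡_ _≡_ φ
  φ-injective {_ , _ , _ , zero}     {_ , _ , _ , zero}     refl = refl
  φ-injective {_ , _ , _ , suc zero} {_ , _ , _ , suc zero} refl = refl
  φ-injective {_ , _ , _ , zero}     {_ , _ , _ , suc zero} eq   =
    contradiction (trans (cong (toℕ ∘ proj₂ ∘ proj₂ ∘ proj₂) eq) toℕ-⟦half⟧) 0≢1+n
  φ-injective {_ , _ , _ , suc zero} {_ , _ , _ , zero}     eq   =
    contradiction (trans (cong (toℕ ∘ proj₂ ∘ proj₂ ∘ proj₂) (sym eq)) toℕ-⟦half⟧) 0≢1+n

  ¬image⇒≢0∧≢half : ∀ {v₁ v₂ v₃ x} → ¬ Image φ (v₁ , v₂ , v₃ , x) → toℕ x ≢ 0 × toℕ x ≢ half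
  ¬image⇒≢0∧≢half {v₁} {v₂} {v₃} {x} ¬img =
    at 0 zero (toℕ-injective {i = x} {j = zero}) ,
    at half (suc zero) (λ X≡half → trans (sym (⟦toℕ⟧ x)) (cong ⟦_⟧ X≡half))
    where
    at : ∀ X e → (toℕ x ≡ X → x ≡ embed e) → toℕ x ≢ X
    at X e x≡ X≡ = ¬img ((v₁ , v₂ , v₃ , e) , cong (λ z → v₁ , v₂ , v₃ , z) (sym (x≡ X≡)))

  covered : ∀ g → ¬ Image φ g → g ∈ Δ 𝒯
  covered (v₁ , v₂ , v₃ , x) ¬img with ¬image⇒≢0∧≢half ¬img | <-cmp (toℕ x) half
  ... | X≢0 , _ | tri< X<half _ _ =
    subst (λ y → mkG v y ∈ Δ 𝒯) (⟦toℕ⟧ x) (proj₁ (realised⇒∈Δ (realise (n≢0⇒n>0 X≢0) X<half v)))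
    where v = v₁ , v₂ , v₃
  ... | _ , X≢half | tri≈ _ X≡half _ = contradiction X≡half X≢half
  ... | _ | tri> _ _ half<X =
    subst (λ y → mkG v y ∈ Δ 𝒯) (sym x≡-t) (proj₂ (realised⇒∈Δ (realise (m<n⇒0<n∸m (toℕ<n x)) t<half v)))
    where
    v = v₁ , v₂ , v₃
    t = M ∸ toℕ x
    X+t≡M : toℕ x + t ≡ M
    X+t≡M = m+[n∸m]≡n (<⇒≤ (toℕ<n x))
    x≡-t : x ≡ -ₘ ⟦ t ⟧
    x≡-t = trans (sym (⟦toℕ⟧ x)) (⟦⟧-complement (toℕ x) t X+t≡M)
    t<half : t < half
    t<half = +-cancelˡ-< half t half
      (subst (half + t <_) (trans X+t≡M (sym (half+half h))) (+-monoˡ-< t half<X))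

  length-𝒯 : length 𝒯 ≡ 8 + (h * 8 + (h * 8 + 16))
  length-𝒯 = cong (8 +_) (begin
    length (concatMap triples (Fs ++ F′s ++ Hs))
      ≡⟨ length-concatMap-++ triples Fs (F′s ++ Hs) ⟩
    length (concatMap triples Fs) + length (concatMap triples (F′s ++ Hs))
      ≡⟨ cong (length (concatMap triples Fs) +_) (length-concatMap-++ triples F′s Hs) ⟩
    length (concatMap triples Fs) + (length (concatMap triples F′s) + 16)
      ≡⟨ cong₂ (λ m n → m + (n + 16)) (eight-each F (λ _ → refl)) (eight-each F′ (λ _ → refl)) ⟩
    h * 8 + (h * 8 + 16) ∎)
    where
    open ≡-Reasoning
    eight-each : ∀ (B : ℕ × ℕ → Block) → (∀ q → length (triples (B q)) ≡ 8) →
                 length (concatMap triples (map B (splits h))) ≡ h * 8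
    eight-each B eight = begin
      length (concatMap triples (map B (splits h))) ≡⟨ cong length (concatMap-map triples B (splits h)) ⟩
      length (concatMap (triples ∘ B) (splits h))   ≡⟨ length-concatMap (triples ∘ B) eight (splits h) ⟩
      length (splits h) * 8                          ≡⟨ cong (_* 8) (length-splits h) ⟩
      h * 8                                          ∎

  length-Δ𝒯 : length (Δ 𝒯) + 16 ≤ 8 * M
  length-Δ𝒯 = ≤-reflexive (begin
    length (Δ 𝒯) + 16                      ≡⟨ cong (_+ 16) (length-concatMap ΔT (λ _ → refl) 𝒯) ⟩
    length 𝒯 * 6 + 16                      ≡⟨ cong (λ n → n * 6 + 16) length-𝒯 ⟩
    (8 + (h * 8 + (h * 8 + 16))) * 6 + 16  ≡⟨ sizes-balance h ⟩
    8 * M                                  ∎)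
    where open ≡-Reasoning

  differenceFamily : ℤ₂⁴-DifferenceFamily M
  differenceFamily = φ , φ-homo , φ-injective , 𝒯 , differenceFamily-byCounting φ 𝒯 refl covered length-Δ𝒯

differenceFamily : ∀ h → ℤ₂⁴-DifferenceFamily (4 * (5 + h * 3))
differenceFamily h = subst ℤ₂⁴-DifferenceFamily (1+[19+12h]≡4[5+3h] h) (Construction.differenceFamily h)

proposition3p6 : (d : ℕ) → d % 6 ≡ 5 →
    Σ (Z2⁴ → G (4 * d)) λ φ → IsHom φ × Injective _≡_ _≡_ φ ×
      Σ (List (Triple (4 * d))) λ 𝒯 → IsDifferenceFamily (4 * d) (Image φ) 𝒯
proposition3p6 d d%6≡5 = subst ℤ₂⁴-DifferenceFamily (cong (4 *_) (sym d≡5+3h)) (differenceFamily (d / 6 * 2))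
  where
  d≡5+3h : d ≡ 5 + d / 6 * 2 * 3
  d≡5+3h = trans (m≡m%n+[m/n]*n d 6) (cong₂ _+_ d%6≡5 (sym (*-assoc (d / 6) 2 3)))
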